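{- Let $k\in\mathbb{N}$, let $F=(f_1,\dots,f_m)$ be a sequence of $k$-relabeling functions, and let $\mathsf{D}$ be a coherent DP-core with identity cleaning equipped with a witness action. If there is an $F$-relabeled $(k,\mathsf{D})$-refutation, then there exists a $k$-instructive tree decomposition $\tau\in\mathcal{T}_k$ such that $G(\tau)\notin\mathcal{P}(\mathsf{D})$.
   Context: Graphs. A graph is a triple $G=(V,E,\rho)$ with $V,E$ finite subsets of $\mathbb{N}$ and $\rho\subseteq E\times V$ such that each edge is incident to exactly two distinct vertices (parallel edges allowed). A graph property is a set of graphs closed under isomorphism. Instructive decompositions. The $k$-instructive alphabet consists of $\mathtt{Leaf}$ (arity 0), $\mathtt{IntroVertex}_u$, $\mathtt{ForgetVertex}_u$ ($u\in[k+1]$), $\mathtt{IntroEdge}_{u,v}$ (distinct $u,v\in[k+1]$) of arity 1, and $\mathtt{Join}$ (arity 2). $\mathcal{T}_k$ is the set of terms legal with respect to bags: $\mathtt{Leaf}$ has bag $\emptyset$; $\mathtt{IntroVertex}_u(\sigma)$ requires $u\notin$ bag$(\sigma)$ and adds $u$; $\mathtt{ForgetVertex}_u(\sigma)$ requires $u\in$ bag$(\sigma)$ and removes $u$; $\mathtt{IntroEdge}_{u,v}(\sigma)$ requires $u,v\in$ bag$(\sigma)$; $\mathtt{Join}(\sigma_1,\sigma_2)$ requires equal child bags. Each $\tau\in\mathcal{T}_k$ defines a graph $G(\tau)$ and top bag $B(\tau)$: $\mathtt{Leaf}$ is the empty graph; $\mathtt{IntroVertex}_u$ adds a fresh isolated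 vertex labeled $u$; $\mathtt{ForgetVertex}_u$ removes label $u$; $\mathtt{IntroEdge}_{u,v}$ adds a new edge between the vertices labeled $u,v$; $\mathtt{Join}$ takes the disjoint union of the child graphs identifying, for each bag label, the two vertices carrying it (edges never identified). DP-cores. A DP-core $\mathsf{D}$ assigns to each $k$ a tuple $\mathsf{D}[k]$: a decidable set $\mathcal{W}_k\subseteq\{0,1\}^*$ of witnesses, $\mathtt{Final}_k:\mathcal{W}_k\to\{0,1\}$, a finite set $\mathtt{Leaf}_k\subseteq\mathcal{W}_k$, functions $\mathtt{IntroVertex}_u,\mathtt{ForgetVertex}_u,\mathtt{IntroEdge}_{u,v}:\mathcal{W}_k\to$ finite subsets of $\mathcal{W}_k$, $\mathtt{Join}:\mathcal{W}_k^2\to$ finite subsets, and a cleaning function $\mathtt{Clean}_k$ on finite subsets; transitions are lifted to finite sets by union. The dynamization $\mathrm{Dyn}_k(\tau)$ is $\mathtt{Leaf}_k$ at leaves and otherwise $\mathtt{Clean}_k$ applied to the lifted transition of the children's dynamizations. $\mathsf{D}[k]$ accepts $\tau$ if $\mathrm{Dyn}_k(\tau)$ contains a final witness ($\mathtt{Final}_k(w)=1$). $\mathcal{P}(\mathsf{D})=\bigcup_k$ (isomorphism closure of $\{G(\tau):\tau\in\mathcal{T}_k$ accepted by $\mathsf{D}[k]\}$). Identity cleaning: each $\mathtt{Clean}_k$ is the identity. Coherent: for $\tau\in\mathcal{T}_k$, $\tau'\in\mathcal{T}_{k'}$ with $G(\tau)\cong G(\tau')$, $\mathsf{D}[k]$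 accepts $\tau$ iff $\mathsf{D}[k']$ accepts $\tau'$. Labels, relabelings, witness actions. Each $w\in\mathcal{W}_k$ has a label set $\mathrm{Lbl}_k(w)\subseteq[k+1]$, $\mathrm{Lbl}_k(S)=\bigcup_{w\in S}\mathrm{Lbl}_k(w)$. A $(k,\mathsf{D})$-state $(b,S)$ ($b\subseteq[k+1]$, $S\subseteq\mathcal{W}_k$ finite) is well-formed if $\mathrm{Lbl}_k(S)\subseteq b$, inconsistent if $S$ has no final witness; the initial state is $(\emptyset,\mathtt{Leaf}_k)$. A $k$-relabeling function is an injective $f:b\to[k+1]$ with $b\subseteq[k+1]$; $\mathcal{F}_k$ is the set of these; $f^{ -1}$ is the inverse on the image and $f\circ g$ the partial composition. A witness action for $\mathsf{D}[k]$ is a partial map $\rho(f,w)\in\mathcal{W}_k$ defined exactly when $\mathrm{Lbl}_k(w)\subseteq\mathrm{dom}(f)$ (extended pointwise to sets) such that, whenever defined: finality is preserved; $\mathrm{Lbl}_k(\rho(f,w))=f(\mathrm{Lbl}_k(w))$; $\rho(f^{ -1},\rho(f,w))=w$; $\rho(f\circ f',w)=\rho(f,\rho(f',w))$; $\rho(f',w)=\rho(f,w)$ when $f'$ extends $f$; and $\rho$ commutes with transitions: $\rho(f,\mathtt{IntroVertex}_u(w))=\mathtt{IntroVertex}_{f(u)}(\rho(f,w))$, likewise for $\mathtt{ForgetVertex}_u$, $\rho(f,\mathtt{IntroEdge}_{u,v}(w))=\mathtt{IntroEdge}_{f(u),f(v)}(\rho(f,w))$, $\rho(f,\mathtt{Join}(w,w'))=\mathtt{Join}(\rho(f,w),\rho(f,w'))$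 (for labels in $\mathrm{dom}(f)$). Being equipped with a witness action means such a $\rho^k$ is fixed for each $k$. Relabeled refutation. For $F=(f_1,\dots,f_m)$, an $F$-relabeled $(k,\mathsf{D})$-refutation is a sequence of states $(b_0,S_0),\dots,(b_m,S_m)$ with $(b_0,S_0)$ initial, $(b_m,S_m)$ inconsistent, all states well-formed, and for each $i\in[m]$ some $j<i$ with $(b_i,S_i)$ equal to one of $(f_i(b_j\cup\{u\}),\rho(f_i,\mathtt{IntroVertex}_u(S_j)))$ ($u\notin b_j$), $(f_i(b_j\setminus\{u\}),\rho(f_i,\mathtt{ForgetVertex}_u(S_j)))$ ($u\in b_j$), $(f_i(b_j),\rho(f_i,\mathtt{IntroEdge}_{u,v}(S_j)))$ (distinct $u,v\in b_j$), or $(f_i(b_j),\rho(f_i,\mathtt{Join}(S_j,\rho(\pi,S_l))))$ ($l<i$, $b_l=b_j$, $\pi$ a permutation of $b_j$), where in each case $\mathrm{dom}(f_i)$ is exactly the bag to which $f_i$ is applied. -}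

module Defs where

open import Data.Nat using (ℕ; zero; suc; _≤_)
open import Data.Fin using (Fin; toℕ; fromℕ; _≟_)
open import Data.Fin.Subset using (Subset; _∈_; _∉_; _⊆_; _∪_; ⁅_⁆; _-_) renaming (⊥ to ∅)
open import Data.Fin.Subset.Properties using (∉⊥; x∈p∪q⁻; x∈p∪q⁺; x∈⁅y⁆⇒x≡y; x∈⁅x⁆; p─q⊆p; x∈p∧x≢y⇒x∈p-y)
open import Data.Bool using (Bool; true; false; _∧_; T)
open import Data.List using (List; []; _∷_; concatMap; allFin)
open import Data.Bool.ListAction using (any)
open import Data.List.Membership.Propositional using () renaming (_∈_ to _∈ˡ_)
open import Data.List.Relation.Unary.Any using (Any)
open import Data.Vec using (tabulate; lookup)
open import Data.Maybe using (Maybe; just; nothing; is-just; _>>=_)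
open import Data.Product using (Σ; ∃; ∃-syntax; _×_; _,_; proj₁; proj₂; map)
open import Data.Sum using (_⊎_; inj₁; inj₂)
open import Data.Empty using (⊥-elim) renaming (⊥ to Empty)
open import Relation.Binary.PropositionalEquality using (_≡_; _≢_; refl)
open import Relation.Nullary using (¬_; yes; no; does)
open import Function.Bundles using (_↔_; _⇔_; Inverse)

-- k-instructive terms, intrinsically legal w.r.t. bags.
-- Labels are Fin (suc k) = [k+1]; a bag is a Subset (suc k).
-- Term k b = legal terms in T_k whose top bag is b.

data Term (k : ℕ) : Subset (suc k) → Set where
  leaf    : Term k ∅
  introV  : ∀ {b} (u : Fin (suc k)) → u ∉ b → Term k b → Term k (b ∪ ⁅ u ⁆)
  forgetV : ∀ {b} (u : Fin (suc k)) → u ∈ b → Term k b → Term k (b - u)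
  introE  : ∀ {b} (u v : Fin (suc k)) → u ≢ v → u ∈ b → v ∈ b → Term k b → Term k b
  join    : ∀ {b} → Term k b → Term k b → Term k b

𝒯 : ℕ → Set
𝒯 k = Σ (Subset (suc k)) (Term k)

-- The graph G(τ).  Vertices/edges of G(τ) are given as (finite) types;
-- labelOf gives the bag label carried by a vertex (if any), lab the
-- vertex carrying a bag label.

mutual
  Vert : ∀ {k b} → Term k b → Set
  Vert leaf                = Empty
  Vert (introV u _ t)      = Maybe (Vert t)      -- nothing = the fresh vertex
  Vert (forgetV u _ t)     = Vert t
  Vert (introE u v _ _ _ t) = Vert t
  Vert (join t₁ t₂)        = Vert t₁ ⊎ Σ (Vert t₂) (λ x → labelOf t₂ x ≡ nothing)

  labelOf : ∀ {k b} (t : Term k b) → Vert t → Maybe (Fin (suc k))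
  labelOf leaf ()
  labelOf (introV u _ t) nothing  = just u
  labelOf (introV u _ t) (just x) = labelOf t x
  labelOf (forgetV u _ t) x with labelOf t x
  ... | nothing = nothing
  ... | just v with v ≟ u
  ...   | yes _ = nothing
  ...   | no _  = just v
  labelOf (introE u v _ _ _ t) x = labelOf t x
  labelOf (join t₁ t₂) (inj₁ x) = labelOf t₁ x
  labelOf (join t₁ t₂) (inj₂ _) = nothing

labelOf-∈ : ∀ {k b} (t : Term k b) (x : Vert t) {v : Fin (suc k)} →
            labelOf t x ≡ just v → v ∈ b
labelOf-∈ leaf () _
labelOf-∈ (introV u _ t) nothing refl = x∈p∪q⁺ (inj₂ (x∈⁅x⁆ u))
labelOf-∈ (introV u _ t) (just x) e = x∈p∪q⁺ (inj₁ (labelOf-∈ t x e))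
labelOf-∈ (forgetV u _ t) x e with labelOf t x in e₀
labelOf-∈ (forgetV u _ t) x () | nothing
... | just w with w ≟ u
labelOf-∈ (forgetV u _ t) x () | just w | yes _
labelOf-∈ (forgetV u _ t) x refl | just w | no w≢u =
  x∈p∧x≢y⇒x∈p-y (labelOf-∈ t x e₀) w≢u
labelOf-∈ (introE u v _ _ _ t) x e = labelOf-∈ t x e
labelOf-∈ (join t₁ t₂) (inj₁ x) e = labelOf-∈ t₁ x e
labelOf-∈ (join t₁ t₂) (inj₂ _) ()

lab : ∀ {k b} (t : Term k b) (v : Fin (suc k)) → v ∈ b → Vert t
lab leaf v p = ⊥-elim (∉⊥ p)
lab (introV {b = b} u _ t) v p with v ≟ u
... | yes _   = nothing
... | no v≢u  = just (lab t v (helper (x∈p∪q⁻ b ⁅ u ⁆ p)))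
  where
  helper : v ∈ b ⊎ v ∈ ⁅ u ⁆ → v ∈ b
  helper (inj₁ q) = q
  helper (inj₂ q) = ⊥-elim (v≢u (x∈⁅y⁆⇒x≡y u q))
lab (forgetV {b = b} u _ t) v p = lab t v (p─q⊆p b ⁅ u ⁆ p)
lab (introE _ _ _ _ _ t) v p = lab t v p
lab (join t₁ t₂) v p = inj₁ (lab t₁ v p)

Edge : ∀ {k b} → Term k b → Set
Edge leaf                 = Empty
Edge (introV u _ t)       = Edge t
Edge (forgetV u _ t)      = Edge t
Edge (introE u v _ _ _ t) = Maybe (Edge t)      -- nothing = the new edge
Edge (join t₁ t₂)         = Edge t₁ ⊎ Edge t₂

-- vertices of the second child of a Join, seen in the joined graph
-- (a vertex carrying label v is identified with the first child's v-vertex)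
embJ : ∀ {k b} (t₁ t₂ : Term k b) → Vert t₂ → Vert (join t₁ t₂)
embJ t₁ t₂ x with labelOf t₂ x in e
... | nothing = inj₂ (x , e)
... | just v  = inj₁ (lab t₁ v (labelOf-∈ t₂ x e))

ends : ∀ {k b} (t : Term k b) → Edge t → Vert t × Vert t
ends leaf ()
ends (introV u _ t) e = map just just (ends t e)
ends (forgetV u _ t) e = ends t e
ends (introE u v _ pu pv t) nothing = lab t u pu , lab t v pv
ends (introE u v _ _ _ t) (just e) = ends t e
ends (join t₁ t₂) (inj₁ e) = map inj₁ inj₁ (ends t₁ e)
ends (join t₁ t₂) (inj₂ e) = map (embJ t₁ t₂) (embJ t₁ t₂) (ends t₂ e)

-- A (multi)graph: vertex set, edge set, and for each edge its two endpoints;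
-- the incidence relation ρ is  ρ(e,x) :⇔ x is an endpoint of e.
record Graph : Set₁ where
  field
    V    : Set
    E    : Set
    endp : E → V × V

Inc : (G : Graph) → Graph.E G → Graph.V G → Set
Inc G e x = x ≡ proj₁ (Graph.endp G e) ⊎ x ≡ proj₂ (Graph.endp G e)

_≅_ : Graph → Graph → Set
G ≅ H = Σ (Graph.V G ↔ Graph.V H) λ φ → Σ (Graph.E G ↔ Graph.E H) λ ψ →
        ∀ e x → Inc G e x ⇔ Inc H (Inverse.to ψ e) (Inverse.to φ x)

G[_] : ∀ {k} → 𝒯 k → Graph
G[ (b , t) ] = record { V = Vert t ; E = Edge t ; endp = ends t }

-- DP-cores.  Finite subsets of W_k are represented by lists, compared
-- with set equality _≈ˢ_.

_≈ˢ_ : ∀ {A : Set} → List A → List A → Set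
S ≈ˢ S' = ∀ w → (w ∈ˡ S) ⇔ (w ∈ˡ S')

record DPCoreₖ (k : ℕ) : Set₁ where
  field
    inW : List Bool → Bool          -- decidable W_k ⊆ {0,1}*
  W : Set
  W = Σ (List Bool) (λ s → T (inW s))
  field
    Final        : W → Bool
    Leaf         : List W
    IntroVertex  : Fin (suc k) → W → List W
    ForgetVertex : Fin (suc k) → W → List W
    IntroEdge    : Fin (suc k) → Fin (suc k) → W → List W
    Join         : W → W → List W
    Clean        : List W → List W

DPCore : Set₁
DPCore = (k : ℕ) → DPCoreₖ k

module _ {k : ℕ} (D : DPCoreₖ k) where
  open DPCoreₖ D

  liftJoin : List W → List W → List W
  liftJoin S S' = concatMap (λ w → concatMap (Join w) S') S

  Dyn : ∀ {b} → Term k b → List W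
  Dyn leaf                 = Leaf
  Dyn (introV u _ t)       = Clean (concatMap (IntroVertex u) (Dyn t))
  Dyn (forgetV u _ t)      = Clean (concatMap (ForgetVertex u) (Dyn t))
  Dyn (introE u v _ _ _ t) = Clean (concatMap (IntroEdge u v) (Dyn t))
  Dyn (join t₁ t₂)         = Clean (liftJoin (Dyn t₁) (Dyn t₂))

  Accepts : 𝒯 k → Set
  Accepts (b , t) = Any (λ w → Final w ≡ true) (Dyn t)

IdentityCleaning : DPCore → Set
IdentityCleaning D = ∀ k S → DPCoreₖ.Clean (D k) S ≡ S

Coherent : DPCore → Set
Coherent D = ∀ k k' (τ : 𝒯 k) (τ' : 𝒯 k') → G[ τ ] ≅ G[ τ' ] →
             Accepts (D k) τ ⇔ Accepts (D k') τ'

_∈𝒫_ : Graph → DPCore → Set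
H ∈𝒫 D = Σ ℕ λ k → Σ (𝒯 k) λ τ → Accepts (D k) τ × (G[ τ ] ≅ H)

Relab : ℕ → Set
Relab k = Fin (suc k) → Maybe (Fin (suc k))

IsRelab : ∀ {k} → Relab k → Set
IsRelab f = ∀ u v x → f u ≡ just x → f v ≡ just x → u ≡ v

dom : ∀ {k} → Relab k → Subset (suc k)
dom f = tabulate (λ u → is-just (f u))

hits : ∀ {n} → Maybe (Fin n) → Fin n → Bool
hits nothing  x = false
hits (just y) x = does (y ≟ x)

image : ∀ {k} → Relab k → Subset (suc k) → Subset (suc k)
image f b = tabulate (λ x → any (λ u → lookup b u ∧ hits (f u) x) (allFin _))

firstHit : ∀ {n} → List (Fin n) → (Fin n → Bool) → Maybe (Fin n)
firstHit []       p = nothing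
firstHit (u ∷ us) p with p u
... | true  = just u
... | false = firstHit us p

inv : ∀ {k} → Relab k → Relab k
inv f x = firstHit (allFin _) (λ u → hits (f u) x)

_∘ʳ_ : ∀ {k} → Relab k → Relab k → Relab k
(f ∘ʳ g) u = g u >>= f

Extends : ∀ {k} → Relab k → Relab k → Set
Extends f' f = ∀ u x → f u ≡ just x → f' u ≡ just x

liftρ : ∀ {A : Set} → (A → Maybe A) → List A → Maybe (List A)
liftρ ρ []       = just []
liftρ ρ (w ∷ S) = ρ w >>= λ w' → liftρ ρ S >>= λ S' → just (w' ∷ S')

record WitnessAction {k : ℕ} (D : DPCoreₖ k) : Set where
  open DPCoreₖ D
  field
    Lbl : W → Subset (suc k)
    ρ   : Relab k → W → Maybe W
    ρ-dom    : ∀ f → IsRelab f → ∀ w →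
               (Lbl w ⊆ dom f → ∃[ w' ] ρ f w ≡ just w') ×
               (∀ w' → ρ f w ≡ just w' → Lbl w ⊆ dom f)
    ρ-final  : ∀ f → IsRelab f → ∀ w w' → ρ f w ≡ just w' → Final w' ≡ Final w
    ρ-Lbl    : ∀ f → IsRelab f → ∀ w w' → ρ f w ≡ just w' → Lbl w' ≡ image f (Lbl w)
    ρ-inv    : ∀ f → IsRelab f → ∀ w w' → ρ f w ≡ just w' → ρ (inv f) w' ≡ just w
    ρ-comp   : ∀ f g → IsRelab f → IsRelab g → ∀ w w' w'' →
               ρ g w ≡ just w' → ρ f w' ≡ just w'' → ρ (f ∘ʳ g) w ≡ just w''
    ρ-ext    : ∀ f f' → IsRelab f → IsRelab f' → Extends f' f → ∀ w w' →
               ρ f w ≡ just w' → ρ f' w ≡ just w'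
    ρ-introV : ∀ f → IsRelab f → ∀ u u' → f u ≡ just u' → ∀ w w' S →
               ρ f w ≡ just w' → liftρ (ρ f) (IntroVertex u w) ≡ just S →
               S ≈ˢ IntroVertex u' w'
    ρ-forgetV : ∀ f → IsRelab f → ∀ u u' → f u ≡ just u' → ∀ w w' S →
               ρ f w ≡ just w' → liftρ (ρ f) (ForgetVertex u w) ≡ just S →
               S ≈ˢ ForgetVertex u' w'
    ρ-introE : ∀ f → IsRelab f → ∀ u v u' v' → u ≢ v → f u ≡ just u' → f v ≡ just v' →
               ∀ w w' S → ρ f w ≡ just w' → liftρ (ρ f) (IntroEdge u v w) ≡ just S →
               S ≈ˢ IntroEdge u' v' w'
    ρ-join   : ∀ f → IsRelab f → ∀ w₁ w₂ w₁' w₂' S →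
               ρ f w₁ ≡ just w₁' → ρ f w₂ ≡ just w₂' →
               liftρ (ρ f) (Join w₁ w₂) ≡ just S → S ≈ˢ Join w₁' w₂'

module _ {k : ℕ} {D : DPCoreₖ k} (A : WitnessAction D) where
  open DPCoreₖ D
  open WitnessAction A

  State : Set
  State = Subset (suc k) × List W

  _≈st_ : State → State → Set
  (b , S) ≈st (b' , S') = (b ≡ b') × (S ≈ˢ S')

  WellFormed : State → Set
  WellFormed (b , S) = ∀ w → w ∈ˡ S → Lbl w ⊆ b

  Inconsistent : State → Set
  Inconsistent (b , S) = ¬ Any (λ w → Final w ≡ true) S

  -- target is obtained from states sⱼ (and sₗ) by one relabeled transition
  -- using f; i is the (0-based) index of f, i.e. j, l < i+1.
  Step : ∀ {m} → Relab k → (Fin (suc m) → State) → Fin m → State → Set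
  Step {m} f s i tgt = Σ (Fin (suc m)) λ j → toℕ j ≤ toℕ i ×
    (let bⱼ = proj₁ (s j) ; Sⱼ = proj₂ (s j) in
      (Σ (Fin (suc k)) λ u → u ∉ bⱼ × dom f ≡ bⱼ ∪ ⁅ u ⁆ × Σ (List W) λ S →
         liftρ (ρ f) (concatMap (IntroVertex u) Sⱼ) ≡ just S ×
         (tgt ≈st (image f (bⱼ ∪ ⁅ u ⁆) , S)))
    ⊎ (Σ (Fin (suc k)) λ u → u ∈ bⱼ × dom f ≡ bⱼ - u × Σ (List W) λ S →
         liftρ (ρ f) (concatMap (ForgetVertex u) Sⱼ) ≡ just S ×
         (tgt ≈st (image f (bⱼ - u) , S)))
    ⊎ (Σ (Fin (suc k)) λ u → Σ (Fin (suc k)) λ v → u ≢ v × u ∈ bⱼ × v ∈ bⱼ ×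
         dom f ≡ bⱼ × Σ (List W) λ S →
         liftρ (ρ f) (concatMap (IntroEdge u v) Sⱼ) ≡ just S ×
         (tgt ≈st (image f bⱼ , S)))
    ⊎ (Σ (Fin (suc m)) λ l → toℕ l ≤ toℕ i × proj₁ (s l) ≡ bⱼ ×
         Σ (Relab k) λ π → IsRelab π × dom π ≡ bⱼ × image π bⱼ ≡ bⱼ ×
         Σ (List W) λ Sₗ' → liftρ (ρ π) (proj₂ (s l)) ≡ just Sₗ' ×
         dom f ≡ bⱼ × Σ (List W) λ S →
         liftρ (ρ f) (liftJoin D Sⱼ Sₗ') ≡ just S ×
         (tgt ≈st (image f bⱼ , S))))

  Refutation : ∀ {m} → (Fin m → Relab k) → Set
  Refutation {m} F = Σ (Fin (suc m) → State) λ s →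
    (s Fin.zero ≈st (∅ , Leaf)) ×
    Inconsistent (s (fromℕ m)) ×
    (∀ i → WellFormed (s i)) ×
    (∀ (i : Fin m) → Step (F i) s i (s (Fin.suc i)))

{-# OPTIONS --safe #-}
module Submission where

-- Replaying the refutation builds terms: by strong induction on i, each state (bᵢ, Sᵢ) is
-- realised by a term with top bag bᵢ whose dynamization equals Sᵢ as a set. A transition
-- is realised by the matching constructor, since identity cleaning lets Dyn commute with
-- the constructors. The relabeling fᵢ is realised by extending it to a permutation π of
-- [k+1] and renaming every label of the term along π: the witness action commutes with
-- the transitions and fixes the label-free leaf witnesses, so the dynamization of the
-- renamed term is the ρ(π)-image of the old one. The term realising the final,
-- inconsistent state is rejected by D[k], hence by coherence its graph is not in 𝒫(D).

open import Defs
open import Data.Nat using (ℕ; suc; _≤_; s≤s)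
open import Data.Nat.Properties using (1+n≰n)
open import Data.Bool using (Bool; false; T; _∧_)
open import Data.Bool.Properties using (T-≡; T-∧)
open import Data.Bool.ListAction using (any)
open import Data.Fin using (Fin; toℕ; fromℕ; _<_; _≟_; punchOut)
open import Data.Fin.Induction using (<-wellFounded)
open import Data.Fin.Properties using (punchOut-injective; injective⇒≤; any?)
open import Data.Fin.Subset using (Subset; _∈_; _∉_; _⊆_; _∪_; ⁅_⁆; _-_; _─_; outside) renaming (⊥ to ∅)
open import Data.Fin.Subset.Properties using (∉⊥; x∈p∪q⁻; x∈p∪q⁺; x∈⁅y⁆⇒x≡y; x∈⁅x⁆; p─q⊆p; x∈p∧x≢y⇒x∈p-y; ⊆-antisym)
open import Data.List using (List; []; _∷_; map; concatMap; allFin)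
open import Data.List.Properties using (concatMap-map; map-concatMap; map-id-local)
open import Data.List.Membership.Propositional using (lose) renaming (_∈_ to _∈ˡ_)
open import Data.List.Membership.Propositional.Properties using (∈-allFin)
open import Data.List.Relation.Binary.BagAndSetEquality using (_∼[_]_; set; [_]-Equality; >>=-cong; map-cong)
open import Data.List.Relation.Binary.Subset.Propositional.Properties using (Any-resp-⊆)
open import Data.List.Relation.Unary.All as All using ()
open import Data.List.Relation.Unary.Any using (here; there; satisfied)
open import Data.List.Relation.Unary.Any.Properties using (any⁺; any⁻)
open import Data.Maybe using (Maybe; just; nothing; is-just)
open import Data.Maybe.Properties using (just-injective; ≡-dec)
open import Data.Product using (Σ; Σ-syntax; ∃-syntax; ∄-syntax; _×_; _,_; proj₁; proj₂)
open import Data.Sum using (inj₁; inj₂)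
open import Data.Unit using (tt)
open import Data.Vec using (tabulate; lookup) renaming (_∷_ to _∷ᵛ_; here to vhere; there to vthere)
open import Data.Vec.Properties using (lookup∘tabulate; []=⇒lookup; lookup⇒[]=)
open import Function using (id; _∘_; _∘′_)
open import Function.Bundles using (Equivalence)
open import Function.Definitions using (Injective)
open import Induction.WellFounded using (Acc; acc)
open import Relation.Binary.Bundles using (Setoid)
open import Relation.Binary.PropositionalEquality using (_≡_; _≢_; refl; sym; trans; cong; subst; module ≡-Reasoning)
open import Relation.Nullary using (¬_; yes; no; ¬?; contradiction)
open import Relation.Nullary.Decidable using (decidable-stable)
import Relation.Binary.Reasoning.Setoid as SetoidReasoning

private variable
  k n : ℕ
  A B : Set

∈⇒T-lookup : ∀ {p : Subset n} {x} → x ∈ p → T (lookup p x)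
∈⇒T-lookup x∈p = Equivalence.from T-≡ ([]=⇒lookup x∈p)

T-lookup⇒∈ : ∀ {p : Subset n} {x} → T (lookup p x) → x ∈ p
T-lookup⇒∈ {p = p} {x} px = lookup⇒[]= x p (Equivalence.to T-≡ px)

∈-tabulate⁻ : ∀ {P : Fin n → Bool} {x} → x ∈ tabulate P → T (P x)
∈-tabulate⁻ {P = P} {x} = subst T (lookup∘tabulate P x) ∘ ∈⇒T-lookup

∈-tabulate⁺ : ∀ {P : Fin n → Bool} {x} → T (P x) → x ∈ tabulate P
∈-tabulate⁺ {P = P} {x} = T-lookup⇒∈ ∘ subst T (sym (lookup∘tabulate P x))

x∈p─q⇒x∉q : ∀ (p q : Subset n) {x} → x ∈ p ─ q → x ∉ q
x∈p─q⇒x∉q (_ ∷ᵛ p) (outside ∷ᵛ q) vhere ()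
x∈p─q⇒x∉q (_ ∷ᵛ p) (_ ∷ᵛ q) (vthere x∈) (vthere x∈q) = x∈p─q⇒x∉q p q x∈ x∈q

x∈p-y⇒x≢y : ∀ {p : Subset n} {x y} → x ∈ p - y → x ≢ y
x∈p-y⇒x≢y {p = p} {y = y} x∈ refl = x∈p─q⇒x∉q p ⁅ y ⁆ x∈ (x∈⁅x⁆ y)

T-hits⇒≡ : ∀ (mx : Maybe (Fin n)) {x} → T (hits mx x) → mx ≡ just x
T-hits⇒≡ (just y) {x} h with y ≟ x
... | yes y≡x = cong just y≡x

T-hits-just : ∀ (x : Fin n) → T (hits (just x) x)
T-hits-just x with x ≟ x
... | yes _   = tt
... | no x≢x = contradiction refl x≢x

preimageIn : Relab k → Subset (suc k) → Fin (suc k) → Fin (suc k) → Bool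
preimageIn f b x u = lookup b u ∧ hits (f u) x

∈-image⁻ : ∀ (f : Relab k) {b x} → x ∈ image f b → ∃[ u ] u ∈ b × f u ≡ just x
∈-image⁻ f {b} {x} x∈
  with satisfied (any⁻ (preimageIn f b x) (allFin _)
                       (∈-tabulate⁻ {P = λ x → any (preimageIn f b x) (allFin _)} x∈))
... | u , hit with Equivalence.to T-∧ hit
...   | u∈b , fu≡x = u , T-lookup⇒∈ u∈b , T-hits⇒≡ (f u) fu≡x

∈-image⁺ : ∀ (f : Relab k) {b u x} → u ∈ b → f u ≡ just x → x ∈ image f b
∈-image⁺ f {b} {u} {x} u∈b fu≡x =
  ∈-tabulate⁺ {P = λ x → any (preimageIn f b x) (allFin _)} (any⁺ (preimageIn f b x)
    (lose (∈-allFin u) (Equivalence.from T-∧ (∈⇒T-lookup u∈b , T-hits))))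
  where
  T-hits : T (hits (f u) x)
  T-hits = subst (λ mx → T (hits mx x)) (sym fu≡x) (T-hits-just x)

∈-dom⁻ : ∀ (f : Relab k) {u} → u ∈ dom f → ∃[ x ] f u ≡ just x
∈-dom⁻ f {u} = is-just⇒just (f u) ∘ ∈-tabulate⁻ {P = is-just ∘ f}
  where
  is-just⇒just : ∀ {A : Set} (mx : Maybe A) → T (is-just mx) → ∃[ x ] mx ≡ just x
  is-just⇒just (just x) _ = x , refl

∈-dom⁺ : ∀ (f : Relab k) {u x} → f u ≡ just x → u ∈ dom f
∈-dom⁺ f fu≡x = ∈-tabulate⁺ {P = is-just ∘ f} (subst (T ∘ is-just) (sym fu≡x) tt)

image-∅ : ∀ (f : Relab k) → image f ∅ ≡ ∅
image-∅ f = ⊆-antisym (λ x∈ → contradiction (proj₁ (proj₂ (∈-image⁻ f x∈))) ∉⊥)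
                      (λ x∈∅ → contradiction x∈∅ ∉⊥)

image-resp-Extends : ∀ {f f' : Relab k} {b} → b ⊆ dom f → Extends f' f → image f b ≡ image f' b
image-resp-Extends {f = f} {f'} {b} b⊆dom f'⊇f = ⊆-antisym
  (λ x∈ → let u , u∈b , fu≡x = ∈-image⁻ f {b} x∈ in ∈-image⁺ f' {b} u∈b (f'⊇f _ _ fu≡x))
  (λ x∈ → let u , u∈b , f'u≡x = ∈-image⁻ f' {b} x∈
              y , fu≡y = ∈-dom⁻ f (b⊆dom u∈b)
          in ∈-image⁺ f {b} u∈b (trans fu≡y (trans (sym (f'⊇f _ _ fu≡y)) f'u≡x)))

total : (Fin (suc k) → Fin (suc k)) → Relab k
total π u = just (π u)

module _ (π : Fin (suc k) → Fin (suc k)) where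

  total-isRelab : Injective _≡_ _≡_ π → IsRelab (total π)
  total-isRelab π-inj u v x πu≡x πv≡x = π-inj (just-injective (trans πu≡x (sym πv≡x)))

  ∈-image-total : ∀ b {u} → u ∈ b → π u ∈ image (total π) b
  ∈-image-total b u∈b = ∈-image⁺ (total π) {b} u∈b refl

  ∉-image-total : Injective _≡_ _≡_ π → ∀ {b u} → u ∉ b → π u ∉ image (total π) b
  ∉-image-total π-inj {b} u∉b πu∈ with ∈-image⁻ (total π) {b} πu∈
  ... | v , v∈b , πv≡πu = u∉b (subst (_∈ b) (π-inj (just-injective πv≡πu)) v∈b)

  image-total-∪⁅⁆ : ∀ b u → image (total π) (b ∪ ⁅ u ⁆) ≡ image (total π) b ∪ ⁅ π u ⁆
  image-total-∪⁅⁆ b u = ⊆-antisym ⊆-to ⊆-from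
    where
    ⊆-to : image (total π) (b ∪ ⁅ u ⁆) ⊆ image (total π) b ∪ ⁅ π u ⁆
    ⊆-to x∈ with ∈-image⁻ (total π) {b ∪ ⁅ u ⁆} x∈
    ... | v , v∈ , refl with x∈p∪q⁻ b ⁅ u ⁆ v∈
    ...   | inj₁ v∈b = x∈p∪q⁺ (inj₁ (∈-image-total b v∈b))
    ...   | inj₂ v∈u rewrite x∈⁅y⁆⇒x≡y u v∈u = x∈p∪q⁺ (inj₂ (x∈⁅x⁆ (π u)))
    ⊆-from : image (total π) b ∪ ⁅ π u ⁆ ⊆ image (total π) (b ∪ ⁅ u ⁆)
    ⊆-from x∈ with x∈p∪q⁻ (image (total π) b) ⁅ π u ⁆ x∈
    ... | inj₁ x∈b with ∈-image⁻ (total π) {b} x∈b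
    ...   | v , v∈b , refl = ∈-image-total (b ∪ ⁅ u ⁆) (x∈p∪q⁺ (inj₁ v∈b))
    ⊆-from x∈ | inj₂ x∈πu rewrite x∈⁅y⁆⇒x≡y (π u) x∈πu =
      ∈-image-total (b ∪ ⁅ u ⁆) (x∈p∪q⁺ (inj₂ (x∈⁅x⁆ u)))

  image-total-minus : Injective _≡_ _≡_ π → ∀ b u → image (total π) (b - u) ≡ image (total π) b - π u
  image-total-minus π-inj b u = ⊆-antisym ⊆-to ⊆-from
    where
    ⊆-to : image (total π) (b - u) ⊆ image (total π) b - π u
    ⊆-to x∈ with ∈-image⁻ (total π) {b - u} x∈
    ... | v , v∈ , refl = x∈p∧x≢y⇒x∈p-y (∈-image-total b (p─q⊆p b ⁅ u ⁆ v∈)) (x∈p-y⇒x≢y v∈ ∘ π-inj)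
    ⊆-from : image (total π) b - π u ⊆ image (total π) (b - u)
    ⊆-from x∈ with ∈-image⁻ (total π) {b} (p─q⊆p _ ⁅ π u ⁆ x∈)
    ... | v , v∈b , refl = ∈-image-total (b - u) (x∈p∧x≢y⇒x∈p-y v∈b (x∈p-y⇒x≢y x∈ ∘ cong π))

-- If every label had an f-preimage, choosing preimages would inject
-- [k+1] into [k+1] ∖ {u}.
fresh-value : ∀ (f : Relab k) → IsRelab f → ∀ {u} → f u ≡ nothing → ∃[ x ] ∄[ v ] f v ≡ just x
fresh-value {k} f f-inj {u} fu≡nothing with any? (λ x → ¬? (any? (λ v → ≡-dec _≟_ (f v) (just x))))
... | yes fresh = fresh
... | no ∄fresh = contradiction (injective⇒≤ g-inj) 1+n≰n
  where
  preimage : ∀ x → ∃[ v ] f v ≡ just x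
  preimage x = decidable-stable (any? (λ v → ≡-dec _≟_ (f v) (just x))) (λ ∄v → ∄fresh (x , ∄v))

  u≢preimage : ∀ x → u ≢ proj₁ (preimage x)
  u≢preimage x refl with () ← trans (sym fu≡nothing) (proj₂ (preimage x))

  g : Fin (suc k) → Fin k
  g x = punchOut (u≢preimage x)

  g-inj : Injective _≡_ _≡_ g
  g-inj {x} {y} gx≡gy = just-injective (begin
    just x              ≡⟨ sym (proj₂ (preimage x)) ⟩
    f (proj₁ (preimage x)) ≡⟨ cong f (punchOut-injective (u≢preimage x) (u≢preimage y) gx≡gy) ⟩
    f (proj₁ (preimage y)) ≡⟨ proj₂ (preimage y) ⟩
    just y              ∎)
    where open ≡-Reasoning

Extends-refl : ∀ {f : Relab k} → Extends f f
Extends-refl _ _ fu≡x = fu≡x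

Extends-trans : ∀ {f g h : Relab k} → Extends h g → Extends g f → Extends h f
Extends-trans h⊇g g⊇f u x fu≡x = h⊇g u x (g⊇f u x fu≡x)

InjectiveExtension : Relab k → (Fin (suc k) → Set) → Set
InjectiveExtension {k} f Defined =
  Σ[ f' ∈ Relab k ] IsRelab f' × Extends f' f × (∀ {u} → Defined u → ∃[ x ] f' u ≡ just x)

extend-at : ∀ (f : Relab k) → IsRelab f → ∀ u → InjectiveExtension f (_≡ u)
extend-at f f-inj u with f u in fu≡
... | just y = f , f-inj , Extends-refl , λ { refl → y , fu≡ }
... | nothing with fresh-value f f-inj fu≡
...   | x , x-fresh = f' , f'-inj , f'⊇f , λ { refl → x , f'u≡x }
  where
  f' : Relab _
  f' v with v ≟ u
  ... | yes _ = just x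
  ... | no _  = f v

  f'u≡x : f' u ≡ just x
  f'u≡x with u ≟ u
  ... | yes _   = refl
  ... | no u≢u = contradiction refl u≢u

  f'-inj : IsRelab f'
  f'-inj a b z f'a≡z f'b≡z with a ≟ u | b ≟ u
  ... | yes a≡u | yes b≡u = trans a≡u (sym b≡u)
  ... | yes _   | no _    = contradiction (b , trans f'b≡z (sym f'a≡z)) x-fresh
  ... | no _    | yes _   = contradiction (a , trans f'a≡z (sym f'b≡z)) x-fresh
  ... | no _    | no _    = f-inj a b z f'a≡z f'b≡z

  f'⊇f : Extends f' f
  f'⊇f v z fv≡z with v ≟ u
  ... | yes refl with () ← trans (sym fu≡) fv≡z
  ... | no _ = fv≡z

extend-over : ∀ (f : Relab k) → IsRelab f → ∀ us → InjectiveExtension f (_∈ˡ us)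
extend-over f f-inj []       = f , f-inj , Extends-refl , λ ()
extend-over f f-inj (u ∷ us) with extend-at f f-inj u
... | f₁ , f₁-inj , f₁⊇f , f₁-at-u with extend-over f₁ f₁-inj us
...   | f₂ , f₂-inj , f₂⊇f₁ , f₂-on-us = f₂ , f₂-inj , Extends-trans f₂⊇f₁ f₁⊇f , defined
  where
  defined : ∀ {v} → v ∈ˡ u ∷ us → ∃[ x ] f₂ v ≡ just x
  defined (here refl) = let x , f₁u≡x = f₁-at-u refl in x , f₂⊇f₁ _ x f₁u≡x
  defined (there v∈us) = f₂-on-us v∈us

extend-to-permutation : ∀ (f : Relab k) → IsRelab f →
                        ∃[ π ] Injective _≡_ _≡_ π × Extends (total π) f
extend-to-permutation f f-inj with extend-over f f-inj (allFin _)
... | f' , f'-inj , f'⊇f , f'-total = π , π-inj , π⊇f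
  where
  π : _ → _
  π u = proj₁ (f'-total (∈-allFin u))

  f'≡π : ∀ u → f' u ≡ just (π u)
  f'≡π u = proj₂ (f'-total (∈-allFin u))

  π-inj : Injective _≡_ _≡_ π
  π-inj {u} {v} πu≡πv = f'-inj u v (π v) (trans (f'≡π u) (cong just πu≡πv)) (f'≡π v)

  π⊇f : Extends (total π) f
  π⊇f u x fu≡x = trans (sym (f'≡π u)) (f'⊇f u x fu≡x)

module _ {A : Set} where
  open Setoid ([ set ]-Equality A) public
    using () renaming (refl to ∼-refl; sym to ∼-sym; trans to ∼-trans; reflexive to ≡⇒∼)

≈ˢ⇒∼ : ∀ {X Y : List A} → X ≈ˢ Y → X ∼[ set ] Y
≈ˢ⇒∼ X≈Y {w} = X≈Y w

concatMap-cong : ∀ {X Y : List A} (T : A → List B) → X ∼[ set ] Y → concatMap T X ∼[ set ] concatMap T Y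
concatMap-cong T X∼Y = >>=-cong X∼Y (λ _ → ∼-refl)

liftJoin-cong : ∀ {k} (D : DPCoreₖ k) {X X' Y Y'} → X ∼[ set ] X' → Y ∼[ set ] Y' →
            liftJoin D X Y ∼[ set ] liftJoin D X' Y'
liftJoin-cong D X∼X' Y∼Y' = >>=-cong X∼X' (λ w → concatMap-cong (DPCoreₖ.Join D w) Y∼Y')

concatMap-natural : ∀ (g : A → B) (T : A → List A) (T' : B → List B) →
                    (∀ w → map g (T w) ∼[ set ] T' (g w)) →
                    ∀ X → concatMap T' (map g X) ∼[ set ] map g (concatMap T X)
concatMap-natural g T T' g∘T∼T'∘g X = begin
  concatMap T' (map g X)     ≡⟨ concatMap-map T' g X ⟩
  concatMap (T' ∘′ g) X      ≈⟨ >>=-cong {xs = X} {ys = X} ∼-refl (λ w → ∼-sym (g∘T∼T'∘g w)) ⟩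
  concatMap (map g ∘′ T) X   ≡⟨ map-concatMap g T X ⟨
  map g (concatMap T X)      ∎
  where open SetoidReasoning ([ set ]-Equality _)

liftρ-map : ∀ {h : A → Maybe A} {g : A → A} → (∀ w → h w ≡ just (g w)) →
            ∀ X → liftρ h X ≡ just (map g X)
liftρ-map h≡g []      = refl
liftρ-map h≡g (w ∷ X) rewrite h≡g w | liftρ-map h≡g X = refl

liftρ-mono : ∀ {h h' : A → Maybe A} → (∀ {w w'} → h w ≡ just w' → h' w ≡ just w') →
             ∀ X {S} → liftρ h X ≡ just S → liftρ h' X ≡ just S
liftρ-mono h⊆h' []      liftX≡S = liftX≡S
liftρ-mono {h = h} h⊆h' (w ∷ X) liftX≡S with h w in hw≡ | liftρ h X in liftX≡
... | just _  | just _  rewrite h⊆h' hw≡ | liftρ-mono h⊆h' X liftX≡ = liftX≡S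
... | just _  | nothing with () ← liftX≡S
... | nothing | _       with () ← liftX≡S

firstHit-false : ∀ {n} (us : List (Fin n)) → firstHit us (λ _ → false) ≡ nothing
firstHit-false []       = refl
firstHit-false (_ ∷ us) = firstHit-false us

ε : Relab k
ε _ = nothing

ε-relab : IsRelab (ε {k})
ε-relab _ _ _ ()

inv-ε-undefined : ∀ {u x} → inv (ε {k}) u ≢ just x
inv-ε-undefined e with () ← trans (sym e) (firstHit-false (allFin _))

module _ {k} {D : DPCoreₖ k} (A : WitnessAction D) where
  open DPCoreₖ D
  open WitnessAction A

  -- ρ ε sends w to some w' and ρ (inv ε) = ρ ε sends w' back, so ρ (ε ∘ʳ ε) = ρ ε fixes w;
  -- every relabeling extends ε.
  unlabelled-fixed : ∀ {w} → Lbl w ⊆ ∅ → ∀ f → IsRelab f → ρ f w ≡ just w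
  unlabelled-fixed {w} w-unlabelled f f-relab
    with proj₁ (ρ-dom ε ε-relab w) (λ x∈ → contradiction (w-unlabelled x∈) ∉⊥)
  ... | w' , ρεw≡w' = ρ-ext ε f ε-relab f-relab (λ _ _ ()) w w ρεw≡w
    where
    ρεw≡w : ρ ε w ≡ just w
    ρεw≡w = ρ-comp ε ε ε-relab ε-relab w w' w ρεw≡w'
      (ρ-ext (inv ε) ε (λ u _ x e _ → contradiction e (inv-ε-undefined {u = u} {x = x})) ε-relab
                       (λ u x e → contradiction e (inv-ε-undefined {u = u} {x = x}))
                       w' w (ρ-inv ε ε-relab w w' ρεw≡w'))

  module Renaming {π : Fin (suc k) → Fin (suc k)} (π-inj : Injective _≡_ _≡_ π) where

    π-relab : IsRelab (total π)
    π-relab = total-isRelab π π-inj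

    private
      ρπ-defined : ∀ w → ∃[ w' ] ρ (total π) w ≡ just w'
      ρπ-defined w = proj₁ (ρ-dom (total π) π-relab w) (λ _ → ∈-dom⁺ (total π) refl)

    act : W → W
    act w = proj₁ (ρπ-defined w)

    ρ-total : ∀ w → ρ (total π) w ≡ just (act w)
    ρ-total w = proj₂ (ρπ-defined w)

    liftρ-total : ∀ X → liftρ (ρ (total π)) X ≡ just (map act X)
    liftρ-total = liftρ-map ρ-total

    act-IntroVertex : ∀ u w → map act (IntroVertex u w) ∼[ set ] IntroVertex (π u) (act w)
    act-IntroVertex u w =
      ≈ˢ⇒∼ (ρ-introV (total π) π-relab u (π u) refl w (act w) _ (ρ-total w) (liftρ-total _))

    act-ForgetVertex : ∀ u w → map act (ForgetVertex u w) ∼[ set ] ForgetVertex (π u) (act w)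
    act-ForgetVertex u w =
      ≈ˢ⇒∼ (ρ-forgetV (total π) π-relab u (π u) refl w (act w) _ (ρ-total w) (liftρ-total _))

    act-IntroEdge : ∀ {u v} → u ≢ v → ∀ w →
                    map act (IntroEdge u v w) ∼[ set ] IntroEdge (π u) (π v) (act w)
    act-IntroEdge {u} {v} u≢v w =
      ≈ˢ⇒∼ (ρ-introE (total π) π-relab u v (π u) (π v) u≢v refl refl w (act w) _ (ρ-total w) (liftρ-total _))

    act-Join : ∀ w₁ w₂ → map act (Join w₁ w₂) ∼[ set ] Join (act w₁) (act w₂)
    act-Join w₁ w₂ =
      ≈ˢ⇒∼ (ρ-join (total π) π-relab w₁ w₂ (act w₁) (act w₂) _ (ρ-total w₁) (ρ-total w₂) (liftρ-total _))

    act-liftJoin : ∀ X Y → liftJoin D (map act X) (map act Y) ∼[ set ] map act (liftJoin D X Y)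
    act-liftJoin X Y = concatMap-natural act _ _
      (λ w → ∼-sym (concatMap-natural act (Join w) (Join (act w)) (act-Join w) Y)) X

    rename : ∀ {b} → Term k b → Term k (image (total π) b)
    rename leaf                 = subst (Term k) (sym (image-∅ (total π))) leaf
    rename (introV {b} u u∉ t)  = subst (Term k) (sym (image-total-∪⁅⁆ π b u))
                                    (introV (π u) (∉-image-total π π-inj u∉) (rename t))
    rename (forgetV {b} u u∈ t) = subst (Term k) (sym (image-total-minus π π-inj b u))
                                    (forgetV (π u) (∈-image-total π b u∈) (rename t))
    rename (introE {b} u v u≢v u∈ v∈ t) =
      introE (π u) (π v) (u≢v ∘′ π-inj) (∈-image-total π b u∈) (∈-image-total π b v∈) (rename t)
    rename (join t₁ t₂)         = join (rename t₁) (rename t₂)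

module Realisation {k} {D : DPCoreₖ k} (A : WitnessAction D)
  (clean-id : ∀ S → DPCoreₖ.Clean D S ≡ S)
  (leaves-unlabelled : ∀ {w} → w ∈ˡ DPCoreₖ.Leaf D → WitnessAction.Lbl A w ⊆ ∅) where
  open DPCoreₖ D
  open WitnessAction A

  Dyn-subst : ∀ {b b'} (b≡b' : b ≡ b') (t : Term k b) → Dyn D (subst (Term k) b≡b' t) ≡ Dyn D t
  Dyn-subst refl t = refl

  module _ {π : Fin (suc k) → Fin (suc k)} (π-inj : Injective _≡_ _≡_ π) where
    open Renaming A π-inj
    open SetoidReasoning ([ set ]-Equality W)

    act-Leaf : map act Leaf ≡ Leaf
    act-Leaf = map-id-local (All.tabulate λ w∈ →
      just-injective (trans (sym (ρ-total _)) (unlabelled-fixed A (leaves-unlabelled w∈) (total π) π-relab)))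

    rename-step : ∀ {T T' : W → List W} {X X'} → (∀ w → map act (T w) ∼[ set ] T' (act w)) →
                  X' ∼[ set ] map act X →
                  Clean (concatMap T' X') ∼[ set ] map act (Clean (concatMap T X))
    rename-step {T} {T'} {X} {X'} act-T X'∼X = begin
      Clean (concatMap T' X')          ≡⟨ clean-id _ ⟩
      concatMap T' X'                  ≈⟨ concatMap-cong T' X'∼X ⟩
      concatMap T' (map act X)         ≈⟨ concatMap-natural act T T' act-T X ⟩
      map act (concatMap T X)          ≡⟨ cong (map act) (clean-id _) ⟨
      map act (Clean (concatMap T X))  ∎

    Dyn-rename : ∀ {b} (t : Term k b) → Dyn D (rename t) ∼[ set ] map act (Dyn D t)
    Dyn-rename leaf = begin
      Dyn D (rename leaf)   ≡⟨ Dyn-subst (sym (image-∅ (total π))) leaf ⟩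
      Leaf                  ≡⟨ act-Leaf ⟨
      map act Leaf          ∎
    Dyn-rename (introV {b} u u∉ t) = ∼-trans (≡⇒∼ (Dyn-subst (sym (image-total-∪⁅⁆ π b u)) _))
      (rename-step {IntroVertex u} {IntroVertex (π u)} (act-IntroVertex u) (Dyn-rename t))
    Dyn-rename (forgetV {b} u u∈ t) = ∼-trans (≡⇒∼ (Dyn-subst (sym (image-total-minus π π-inj b u)) _))
      (rename-step {ForgetVertex u} {ForgetVertex (π u)} (act-ForgetVertex u) (Dyn-rename t))
    Dyn-rename (introE u v u≢v u∈ v∈ t) =
      rename-step {IntroEdge u v} {IntroEdge (π u) (π v)} (act-IntroEdge u≢v) (Dyn-rename t)
    Dyn-rename (join t₁ t₂) = begin
      Clean (liftJoin D (Dyn D (rename t₁)) (Dyn D (rename t₂)))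
        ≡⟨ clean-id _ ⟩
      liftJoin D (Dyn D (rename t₁)) (Dyn D (rename t₂))
        ≈⟨ liftJoin-cong D (Dyn-rename t₁) (Dyn-rename t₂) ⟩
      liftJoin D (map act (Dyn D t₁)) (map act (Dyn D t₂))
        ≈⟨ act-liftJoin (Dyn D t₁) (Dyn D t₂) ⟩
      map act (liftJoin D (Dyn D t₁) (Dyn D t₂))
        ≡⟨ cong (map act) (clean-id _) ⟨
      map act (Dyn D (join t₁ t₂)) ∎

  Realisable : State A → Set
  Realisable (b , S) = Σ[ t ∈ Term k b ] Dyn D t ∼[ set ] S

  realisable-resp : ∀ {b b' S S'} → b ≡ b' → S ∼[ set ] S' → Realisable (b , S) → Realisable (b' , S')
  realisable-resp refl S∼S' (t , t∼S) = t , ∼-trans t∼S S∼S'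

  realisable-≈st : ∀ {s s'} → _≈st_ A s s' → Realisable s' → Realisable s
  realisable-≈st (b≡b' , S≈S') = realisable-resp (sym b≡b') (∼-sym (≈ˢ⇒∼ S≈S'))

  realisable-leaf : Realisable (∅ , Leaf)
  realisable-leaf = leaf , ∼-refl

  realisable-introV : ∀ {b X u} → u ∉ b → Realisable (b , X) →
                      Realisable (b ∪ ⁅ u ⁆ , concatMap (IntroVertex u) X)
  realisable-introV u∉b (t , t∼X) =
    introV _ u∉b t , ∼-trans (≡⇒∼ (clean-id _)) (concatMap-cong _ t∼X)

  realisable-forgetV : ∀ {b X u} → u ∈ b → Realisable (b , X) →
                       Realisable (b - u , concatMap (ForgetVertex u) X)
  realisable-forgetV u∈b (t , t∼X) =
    forgetV _ u∈b t , ∼-trans (≡⇒∼ (clean-id _)) (concatMap-cong _ t∼X)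

  realisable-introE : ∀ {b X u v} → u ≢ v → u ∈ b → v ∈ b → Realisable (b , X) →
                      Realisable (b , concatMap (IntroEdge u v) X)
  realisable-introE u≢v u∈b v∈b (t , t∼X) =
    introE _ _ u≢v u∈b v∈b t , ∼-trans (≡⇒∼ (clean-id _)) (concatMap-cong _ t∼X)

  realisable-join : ∀ {b X Y} → Realisable (b , X) → Realisable (b , Y) → Realisable (b , liftJoin D X Y)
  realisable-join (t₁ , t₁∼X) (t₂ , t₂∼Y) =
    join t₁ t₂ , ∼-trans (≡⇒∼ (clean-id _)) (liftJoin-cong D t₁∼X t₂∼Y)

  realisable-relabel : ∀ {f b X S} → IsRelab f → dom f ≡ b → liftρ (ρ f) X ≡ just S →
                       Realisable (b , X) → Realisable (image f b , S)
  realisable-relabel {f} {b} {X} {S} f-relab dom-f≡b ρfX≡S (t , t∼X)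
    with extend-to-permutation f f-relab
  ... | π , π-inj , π⊇f = realisable-resp bag≡ (≡⇒∼ act-X≡S)
                            (rename t , ∼-trans (Dyn-rename π-inj t) (map-cong (λ _ → refl) t∼X))
    where
    open Renaming A π-inj

    bag≡ : image (total π) b ≡ image f b
    bag≡ = sym (image-resp-Extends (subst (b ⊆_) (sym dom-f≡b) id) π⊇f)

    act-X≡S : map act X ≡ S
    act-X≡S = just-injective (trans (sym (liftρ-total X))
      (liftρ-mono (ρ-ext f (total π) f-relab π-relab π⊇f _ _) X ρfX≡S))

  realisable-step : ∀ {m f} {s : Fin (suc m) → State A} {i tgt} → IsRelab f →
                    (∀ j → toℕ j ≤ toℕ i → Realisable (s j)) → Step A f s i tgt → Realisable tgt
  realisable-step f-relab earlier (j , j≤i , inj₁ (u , u∉ , dom-f , S , ρ-S , tgt≈)) =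
    realisable-≈st tgt≈ (realisable-relabel f-relab dom-f ρ-S (realisable-introV u∉ (earlier j j≤i)))
  realisable-step f-relab earlier (j , j≤i , inj₂ (inj₁ (u , u∈ , dom-f , S , ρ-S , tgt≈))) =
    realisable-≈st tgt≈ (realisable-relabel f-relab dom-f ρ-S (realisable-forgetV u∈ (earlier j j≤i)))
  realisable-step f-relab earlier
    (j , j≤i , inj₂ (inj₂ (inj₁ (u , v , u≢v , u∈ , v∈ , dom-f , S , ρ-S , tgt≈)))) =
    realisable-≈st tgt≈ (realisable-relabel f-relab dom-f ρ-S (realisable-introE u≢v u∈ v∈ (earlier j j≤i)))
  realisable-step {s = s} f-relab earlier (j , j≤i , inj₂ (inj₂ (inj₂
    (l , l≤i , bₗ≡bⱼ , π , π-relab , dom-π , π-bⱼ , Sₗ' , ρ-Sₗ , dom-f , S , ρ-S , tgt≈)))) =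
    realisable-≈st tgt≈ (realisable-relabel f-relab dom-f ρ-S (realisable-join (earlier j j≤i) realised-Sₗ'))
    where
    realised-Sₗ' : Realisable (proj₁ (s j) , Sₗ')
    realised-Sₗ' = realisable-resp (trans (cong (image π) bₗ≡bⱼ) π-bⱼ) ∼-refl
      (realisable-relabel π-relab (trans dom-π (sym bₗ≡bⱼ)) ρ-Sₗ (earlier l l≤i))

  inconsistent-realisable⇒rejected : ∀ {s} → Inconsistent A s → Realisable s →
                                     Σ[ τ ∈ 𝒯 k ] ¬ Accepts D τ
  inconsistent-realisable⇒rejected no-final (t , t∼S) =
    (_ , t) , no-final ∘′ Any-resp-⊆ (Equivalence.to t∼S)

refutation⇒rejected-term : ∀ {k} {D : DPCoreₖ k} (A : WitnessAction D) → (∀ S → DPCoreₖ.Clean D S ≡ S) →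
                           ∀ {m} {F : Fin m → Relab k} → (∀ i → IsRelab (F i)) →
                           Refutation A F → Σ[ τ ∈ 𝒯 k ] ¬ Accepts D τ
refutation⇒rejected-term {k} {D} A clean-id {m} F-relab (s , s₀≈ , sₘ-inconsistent , s-wf , steps) =
  inconsistent-realisable⇒rejected sₘ-inconsistent (realisable-from (fromℕ m) (<-wellFounded _))
  where
  leaves-unlabelled : ∀ {w} → w ∈ˡ DPCoreₖ.Leaf D → WitnessAction.Lbl A w ⊆ ∅
  leaves-unlabelled {w} w∈ =
    subst (WitnessAction.Lbl A w ⊆_) (proj₁ s₀≈) (s-wf Fin.zero w (Equivalence.from (proj₂ s₀≈ w) w∈))

  open Realisation A clean-id leaves-unlabelled

  realisable-from : ∀ j → Acc _<_ j → Realisable (s j)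
  realisable-from Fin.zero _ = realisable-≈st s₀≈ realisable-leaf
  realisable-from (Fin.suc i) (acc earlier) =
    realisable-step (F-relab i) (λ j j≤i → realisable-from j (earlier {j} (s≤s j≤i))) (steps i)

theorem2 : (k : ℕ) (m : ℕ) (F : Fin m → Relab k) → (∀ i → IsRelab (F i)) →
    (D : DPCore) → Coherent D → IdentityCleaning D →
    (A : (k' : ℕ) → WitnessAction (D k')) →
    Refutation (A k) F →
    Σ (𝒯 k) (λ τ → ¬ (G[ τ ] ∈𝒫 D))
theorem2 k m F F-relab D coherent clean-id A refutation
  with refutation⇒rejected-term (A k) (clean-id k) F-relab refutation
... | τ , τ-rejected = τ , λ (k' , τ' , τ'-accepted , G[τ']≅G[τ]) →
  τ-rejected (Equivalence.to (coherent k' k τ' τ G[τ']≅G[τ]) τ'-accepted)
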